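{- Let $q$ be a prime power and let $h,k$ be integers with $4\le h\le k$. Let $s\ge 0$ and $r\ge 1$ be integers, let $i_1<\dots<i_s$ be indices in $\{1,\dots,h\}$ and $j_1<\dots<j_r$ indices in $\{h+1,\dots,k\}$, and let $a_{i_1},\dots,a_{i_s},b_{j_1},\dots,b_{j_r}\in\mathbb{F}_q^*$. Let $\Lambda$ be the number of $(x_1,\dots,x_k)\in\mathbb{F}_q^k$ satisfying simultaneously $$a_{i_1}x_{i_1}+\dots+a_{i_s}x_{i_s}+b_{j_1}x_{j_1}+\dots+b_{j_r}x_{j_r}=0\quad\text{and}\quad (x_1+\dots+x_h)\,x_1x_2\cdots x_h=0.$$ Then $$\Lambda=q^{k-1}-q^{k-h-1}(q-1)^h+\psi_h q^{k-h-1}=q^{k-h-1}\bigl(q^h+\psi_h-(q-1)^h\bigr).$$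
   Context: For an integer $m\ge 0$, $\psi_m$ denotes the number of $(y_1,\dots,y_m)\in\mathbb{F}_q^m$ with $y_1+\dots+y_m=0$ and $y_i\neq 0$ for all $i$ (so $\psi_0=1$). -}

module Defs where

open import Level using (Level; suc)
open import Data.Nat as ℕ using (ℕ; zero)
open import Data.Fin as Fin using (Fin; toℕ)
open import Data.Vec using (Vec; []; _∷_; lookup)
open import Data.List using (List; [_]; map; concatMap; filter; length)
open import Data.List.Relation.Unary.Unique.Propositional using (Unique)
open import Data.List.Membership.Propositional using (_∈_)
open import Data.Product using (∃; _×_)
open import Relation.Nullary using (¬_; Dec; yes; no)
open import Relation.Nullary.Decidable using (_×-dec_)
open import Relation.Binary.PropositionalEquality using (_≡_; _≢_)
open import Relation.Binary.Definitions using (DecidableEquality)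
open import Algebra.Structures using (IsCommutativeRing)

record FiniteField (c : Level) : Set (suc c) where
  infixl 6 _+_
  infixl 7 _*_
  field
    Carrier  : Set c
    _+_ _*_  : Carrier → Carrier → Carrier
    -_       : Carrier → Carrier
    0# 1#    : Carrier
    isCommutativeRing : IsCommutativeRing _≡_ _+_ _*_ -_ 0# 1#
    1≢0      : 1# ≢ 0#
    inverse  : ∀ x → x ≢ 0# → ∃ λ y → x * y ≡ 1#
    _≟_      : DecidableEquality Carrier
    elements : List Carrier
    unique   : Unique elements
    complete : ∀ x → x ∈ elements

  order : ℕ
  order = length elements

  allVecs : (n : ℕ) → List (Vec Carrier n)
  allVecs zero = [ [] ]
  allVecs (ℕ.suc n) = concatMap (λ a → map (a ∷_) (allVecs n)) elements

  sumF : (n : ℕ) → (Fin n → Carrier) → Carrier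
  sumF zero f = 0#
  sumF (ℕ.suc n) f = f Fin.zero + sumF n (λ i → f (Fin.suc i))

  prodF : (n : ℕ) → (Fin n → Carrier) → Carrier
  prodF zero f = 1#
  prodF (ℕ.suc n) f = f Fin.zero * prodF n (λ i → f (Fin.suc i))

  nonzeroAll? : (m : ℕ) (y : Vec Carrier m) → Dec (∀ i → lookup y i ≢ 0#)
  nonzeroAll? zero [] = yes λ ()
  nonzeroAll? (ℕ.suc m) (a ∷ y) with a ≟ 0# | nonzeroAll? m y
  ... | yes a≡0 | _ = no λ h → h Fin.zero a≡0
  ... | no a≢0 | no n = no λ h → n λ i → h (Fin.suc i)
  ... | no a≢0 | yes p = yes λ { Fin.zero → a≢0 ; (Fin.suc i) → p i }

  ψ : ℕ → ℕ
  ψ m = length (filter (λ y → (sumF m (lookup y) ≟ 0#) ×-dec nonzeroAll? m y) (allVecs m))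

  -- Λ : number of x ∈ F^k with
  --   Σ_t a_t x_{i_t} + Σ_t b_t x_{j_t} = 0   and   (x_1+…+x_h) x_1⋯x_h = 0.
  -- Positions are 0-based: position p : Fin k stands for x_{p+1}; the
  -- indices i_t : Fin h are embedded into Fin k via inject≤.
  Λ : (h k : ℕ) → h ℕ.≤ k → (s r : ℕ)
      → (i : Fin s → Fin h) → (a : Fin s → Carrier)
      → (j : Fin r → Fin k) → (b : Fin r → Carrier) → ℕ
  Λ h k h≤k s r i a j b = length (filter (λ x → (L x ≟ 0#) ×-dec (M x ≟ 0#)) (allVecs k))
    where
    xh : Vec Carrier k → Fin h → Carrier
    xh x t = lookup x (Fin.inject≤ t h≤k)
    L : Vec Carrier k → Carrier
    L x = sumF s (λ t → a t * xh x (i t)) + sumF r (λ t → b t * lookup x (j t))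
    M : Vec Carrier k → Carrier
    M x = sumF h (xh x) * prodF h (xh x)

module Submission where

-- Write q = |F| and m = k − h − 1.  The linear form contains the
-- variable x_p with p = j₁ > h and nonzero coefficient b_{j₁}; no other term of
-- either equation involves x_p.  Solving the linear equation for x_p therefore
-- cuts the count of the remaining conditions by exactly the factor q.  The
-- second equation only involves x_1 … x_h, so the k − h other coordinates are
-- free, and
--          q · Λ = q^(k−h) · Z_h,   Z_h = #{ y ∈ F^h : (Σ y)(Π y) = 0 }.
-- Splitting F^h by whether all y_i ≠ 0 (then Π y ≠ 0, so the condition is
-- Σ y = 0, counted by ψ_h) or not (then Π y = 0) gives Z_h + (q−1)^h = q^h + ψ_h.
-- Hence Λ = q^m (q^h + ψ_h − (q−1)^h), the claimed formula in ℤ.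

open import Defs
open import Level using (Level)
open import Data.Nat as ℕ using (ℕ; _∸_; zero; suc; _+_; _*_; _^_; s≤s; z≤n)
open import Data.Fin as Fin using (Fin; toℕ)
open import Data.Integer as ℤ using (ℤ; +_)
open import Relation.Binary.PropositionalEquality
  using (_≡_; _≢_; refl; sym; trans; cong; cong₂; module ≡-Reasoning)
open import Data.List using (List; []; _∷_; _++_; map; concatMap; filter; length)
open import Data.Vec using (Vec; []; _∷_; lookup; _[_]≔_)
open import Data.Vec.Properties using (lookup∘update′)
open import Data.Vec.Functional using () renaming (_∷_ to _◂_)
open import Data.Product using (_,_)
open import Data.Empty using (⊥-elim)
open import Relation.Nullary using (¬_; Dec; yes; no)
open import Relation.Nullary.Decidable using (_×-dec_; ¬?)
open import Relation.Unary using (Pred; Decidable)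
open import Data.List.Membership.Propositional using (_∈_)
open import Data.List.Relation.Unary.Any using (here; there)
open import Data.List.Relation.Unary.All using () renaming (lookup to All-lookup)
open import Data.List.Relation.Unary.AllPairs using (_∷_)
open import Data.List.Relation.Unary.Unique.Propositional using (Unique)
open import Algebra.Structures using (IsCommutativeRing)
import Data.Nat.Properties as ℕP
open import Algebra.Properties.CommutativeSemigroup ℕP.+-commutativeSemigroup using (interchange)
open import Data.Integer.Tactic.RingSolver using (solve-∀)
import Data.Fin.Properties as FinP
import Data.Integer.Properties as ℤP

open ≡-Reasoning

⟦_⟧ : ∀ {p} {P : Set p} → Dec P → ℕ
⟦ yes _ ⟧ = 1
⟦ no _ ⟧ = 0

⟦⟧-× : ∀ {p q} {P : Set p} {Q : Set q} (dp : Dec P) (dq : Dec Q) → ⟦ dp ×-dec dq ⟧ ≡ ⟦ dp ⟧ * ⟦ dq ⟧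
⟦⟧-× (yes _) (yes _) = refl
⟦⟧-× (yes _) (no _) = refl
⟦⟧-× (no _) _ = refl

⟦⟧-⇔ : ∀ {p q} {P : Set p} {Q : Set q} → (P → Q) → (Q → P) → (dp : Dec P) (dq : Dec Q) → ⟦ dp ⟧ ≡ ⟦ dq ⟧
⟦⟧-⇔ f g (yes _) (yes _) = refl
⟦⟧-⇔ f g (yes p) (no ¬q) = ⊥-elim (¬q (f p))
⟦⟧-⇔ f g (no ¬p) (yes q) = ⊥-elim (¬p (g q))
⟦⟧-⇔ f g (no _) (no _) = refl

∑ : ∀ {a} {A : Set a} → List A → (A → ℕ) → ℕ
∑ [] f = 0
∑ (x ∷ xs) f = f x + ∑ xs f

syntax ∑ l (λ x → e) = ∑[ x ∈ l ] e

module _ {a} {A : Set a} where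
  ∑-cong : ∀ (l : List A) {f g : A → ℕ} → (∀ x → f x ≡ g x) → ∑ l f ≡ ∑ l g
  ∑-cong [] e = refl
  ∑-cong (x ∷ l) e = cong₂ _+_ (e x) (∑-cong l e)

  ∑-++ : ∀ (l₁ l₂ : List A) f → ∑ (l₁ ++ l₂) f ≡ ∑ l₁ f + ∑ l₂ f
  ∑-++ [] l₂ f = refl
  ∑-++ (x ∷ l₁) l₂ f = trans (cong (_+_ (f x)) (∑-++ l₁ l₂ f)) (sym (ℕP.+-assoc (f x) _ _))

  ∑-+ : ∀ (l : List A) f g → (∑[ x ∈ l ] (f x + g x)) ≡ ∑ l f + ∑ l g
  ∑-+ [] f g = refl
  ∑-+ (x ∷ l) f g = trans (cong (_+_ (f x + g x)) (∑-+ l f g)) (interchange (f x) (g x) (∑ l f) (∑ l g))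

  ∑-*ˡ : ∀ (l : List A) n f → (∑[ x ∈ l ] (n * f x)) ≡ n * ∑ l f
  ∑-*ˡ [] n f = sym (ℕP.*-zeroʳ n)
  ∑-*ˡ (x ∷ l) n f = trans (cong (_+_ (n * f x)) (∑-*ˡ l n f)) (sym (ℕP.*-distribˡ-+ n (f x) (∑ l f)))

  ∑-*ʳ : ∀ (l : List A) n f → (∑[ x ∈ l ] (f x * n)) ≡ ∑ l f * n
  ∑-*ʳ [] n f = refl
  ∑-*ʳ (x ∷ l) n f = trans (cong (_+_ (f x * n)) (∑-*ʳ l n f)) (sym (ℕP.*-distribʳ-+ n (f x) (∑ l f)))

  ∑-const : ∀ (l : List A) n → (∑[ _ ∈ l ] n) ≡ length l * n
  ∑-const [] n = refl
  ∑-const (x ∷ l) n = cong (_+_ (n)) (∑-const l n)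

  length-filter : ∀ {p} {P : Pred A p} (P? : Decidable P) (l : List A) →
                  length (filter P? l) ≡ ∑[ x ∈ l ] ⟦ P? x ⟧
  length-filter P? [] = refl
  length-filter P? (x ∷ l) with P? x
  ... | yes _ = cong suc (length-filter P? l)
  ... | no _ = length-filter P? l

module _ {a b} {A : Set a} {B : Set b} where
  ∑-map : ∀ (g : A → B) (l : List A) f → ∑ (map g l) f ≡ ∑[ x ∈ l ] f (g x)
  ∑-map g [] f = refl
  ∑-map g (x ∷ l) f = cong (_+_ (f (g x))) (∑-map g l f)

  ∑-concatMap : ∀ (g : A → List B) (l : List A) f → ∑ (concatMap g l) f ≡ ∑[ x ∈ l ] ∑ (g x) f
  ∑-concatMap g [] f = refl
  ∑-concatMap g (x ∷ l) f = trans (∑-++ (g x) (concatMap g l) f) (cong (_+_ (∑ (g x) f)) (∑-concatMap g l f))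

  ∑-swap : ∀ (l₁ : List A) (l₂ : List B) (f : A → B → ℕ) →
           (∑[ x ∈ l₁ ] ∑[ y ∈ l₂ ] f x y) ≡ (∑[ y ∈ l₂ ] ∑[ x ∈ l₁ ] f x y)
  ∑-swap [] l₂ f = sym (trans (∑-const l₂ 0) (ℕP.*-zeroʳ (length l₂)))
  ∑-swap (x ∷ l₁) l₂ f = trans (cong (_+_ (∑ l₂ (f x))) (∑-swap l₁ l₂ f)) (sym (∑-+ l₂ (f x) _))

module Counting {c : Level} (F : FiniteField c) where
  open FiniteField F renaming (_+_ to _+F_; _*_ to _*F_; -_ to -F_)
  private module R = IsCommutativeRing isCommutativeRing

  q : ℕ
  q = order

  order-pos : 1 ℕ.≤ q
  order-pos = nonempty elements (complete 0#)
    where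
    nonempty : ∀ (l : List Carrier) {e} → e ∈ l → 1 ℕ.≤ length l
    nonempty (_ ∷ _) _ = s≤s z≤n

  ∑-allVecs : ∀ n (f : Vec Carrier (suc n) → ℕ) →
              ∑ (allVecs (suc n)) f ≡ ∑[ a ∈ elements ] ∑[ y ∈ allVecs n ] f (a ∷ y)
  ∑-allVecs n f = trans (∑-concatMap (λ a → map (a ∷_) (allVecs n)) elements f)
                        (∑-cong elements (λ a → ∑-map (a ∷_) (allVecs n) f))

  ∑-allVecs-const : ∀ n m → (∑[ _ ∈ allVecs n ] m) ≡ q ^ n * m
  ∑-allVecs-const zero m = trans (ℕP.+-identityʳ m) (sym (ℕP.*-identityˡ m))
  ∑-allVecs-const (suc n) m = begin
    (∑[ _ ∈ allVecs (suc n) ] m)           ≡⟨ ∑-allVecs n _ ⟩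
    (∑[ _ ∈ elements ] ∑[ _ ∈ allVecs n ] m) ≡⟨ ∑-cong elements (λ _ → ∑-allVecs-const n m) ⟩
    (∑[ _ ∈ elements ] (q ^ n * m))          ≡⟨ ∑-const elements _ ⟩
    q * (q ^ n * m)                          ≡⟨ sym (ℕP.*-assoc q (q ^ n) m) ⟩
    q ^ suc n * m                            ∎

  ⟦⟧-≡0 : ∀ {x y} → x ≡ y → ⟦ x ≟ 0# ⟧ ≡ ⟦ y ≟ 0# ⟧
  ⟦⟧-≡0 refl = refl

  count-≡ : ∀ e → (∑[ y ∈ elements ] ⟦ y ≟ e ⟧) ≡ 1
  count-≡ e = once elements unique (complete e)
    where
    never : ∀ (l : List Carrier) → ¬ (e ∈ l) → (∑[ y ∈ l ] ⟦ y ≟ e ⟧) ≡ 0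
    never [] _ = refl
    never (x ∷ l) e∉ with x ≟ e
    ... | yes refl = ⊥-elim (e∉ (here refl))
    ... | no _ = never l (λ e∈ → e∉ (there e∈))
    once : ∀ (l : List Carrier) → Unique l → e ∈ l → (∑[ y ∈ l ] ⟦ y ≟ e ⟧) ≡ 1
    once (x ∷ l) (x∉ ∷ _) e∈ with x ≟ e
    ... | yes refl = cong suc (never l (λ x∈ → All-lookup x∉ x∈ refl))
    once (x ∷ l) (_ ∷ u) (here e≡x)  | no x≢e = ⊥-elim (x≢e (sym e≡x))
    once (x ∷ l) (_ ∷ u) (there e∈) | no _ = once l u e∈

  count-≢0 : (∑[ a ∈ elements ] ⟦ ¬? (a ≟ 0#) ⟧) ≡ q ∸ 1
  count-≢0 = begin
    ∑ elements nz                                ≡⟨ sym (ℕP.m+n∸m≡n 1 _) ⟩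
    (1 + ∑ elements nz) ∸ 1                      ≡⟨ cong (λ z → (z + ∑ elements nz) ∸ 1) (sym (count-≡ 0#)) ⟩
    (∑ elements (λ a → ⟦ a ≟ 0# ⟧) + ∑ elements nz) ∸ 1
                                                 ≡⟨ cong (_∸ 1) (sym (∑-+ elements _ nz)) ⟩
    (∑[ a ∈ elements ] (⟦ a ≟ 0# ⟧ + nz a)) ∸ 1 ≡⟨ cong (_∸ 1) (∑-cong elements one) ⟩
    (∑[ _ ∈ elements ] 1) ∸ 1                    ≡⟨ cong (_∸ 1) (trans (∑-const elements 1) (ℕP.*-identityʳ q)) ⟩
    q ∸ 1                                        ∎
    where
    nz : Carrier → ℕ
    nz a = ⟦ ¬? (a ≟ 0#) ⟧
    one : ∀ a → ⟦ a ≟ 0# ⟧ + nz a ≡ 1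
    one a with a ≟ 0#
    ... | yes _ = refl
    ... | no _ = refl

  integral : ∀ x y → x ≢ 0# → y ≢ 0# → x *F y ≢ 0#
  integral x y x≢0 y≢0 xy≡0 with inverse x x≢0
  ... | x⁻¹ , xx⁻¹≡1 = y≢0 (begin
    y                  ≡⟨ sym (R.*-identityˡ y) ⟩
    1# *F y            ≡⟨ cong (_*F y) (trans (sym xx⁻¹≡1) (R.*-comm x x⁻¹)) ⟩
    (x⁻¹ *F x) *F y    ≡⟨ R.*-assoc x⁻¹ x y ⟩
    x⁻¹ *F (x *F y)    ≡⟨ cong (x⁻¹ *F_) xy≡0 ⟩
    x⁻¹ *F 0#          ≡⟨ R.zeroʳ x⁻¹ ⟩
    0#                 ∎)

  count-linear-root : ∀ c′ → c′ ≢ 0# → ∀ d → (∑[ y ∈ elements ] ⟦ ((c′ *F y) +F d) ≟ 0# ⟧) ≡ 1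
  count-linear-root c′ c′≢0 d with inverse c′ c′≢0
  ... | c⁻¹ , cc⁻¹≡1 =
    trans (∑-cong elements (λ y → ⟦⟧-⇔ (solution y) (is-root y) (((c′ *F y) +F d) ≟ 0#) (y ≟ root)))
          (count-≡ root)
    where
    root : Carrier
    root = c⁻¹ *F (-F d)
    solution : ∀ y → (c′ *F y) +F d ≡ 0# → y ≡ root
    solution y eq = begin
      y                  ≡⟨ sym (R.*-identityˡ y) ⟩
      1# *F y            ≡⟨ cong (_*F y) (trans (sym cc⁻¹≡1) (R.*-comm c′ c⁻¹)) ⟩
      (c⁻¹ *F c′) *F y   ≡⟨ R.*-assoc c⁻¹ c′ y ⟩
      c⁻¹ *F (c′ *F y)   ≡⟨ cong (c⁻¹ *F_) cy≡-d ⟩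
      root               ∎
      where
      cy≡-d : c′ *F y ≡ -F d
      cy≡-d = begin
        c′ *F y                          ≡⟨ sym (R.+-identityʳ _) ⟩
        (c′ *F y) +F 0#                  ≡⟨ cong ((c′ *F y) +F_) (sym (R.-‿inverseʳ d)) ⟩
        (c′ *F y) +F (d +F (-F d))       ≡⟨ sym (R.+-assoc _ _ _) ⟩
        ((c′ *F y) +F d) +F (-F d)       ≡⟨ cong (_+F (-F d)) eq ⟩
        0# +F (-F d)                     ≡⟨ R.+-identityˡ _ ⟩
        -F d                             ∎
    is-root : ∀ y → y ≡ root → (c′ *F y) +F d ≡ 0#
    is-root y refl = begin
      (c′ *F (c⁻¹ *F (-F d))) +F d   ≡⟨ cong (_+F d) (sym (R.*-assoc c′ c⁻¹ (-F d))) ⟩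
      ((c′ *F c⁻¹) *F (-F d)) +F d   ≡⟨ cong (λ z → (z *F (-F d)) +F d) cc⁻¹≡1 ⟩
      (1# *F (-F d)) +F d            ≡⟨ cong (_+F d) (R.*-identityˡ _) ⟩
      (-F d) +F d                    ≡⟨ R.-‿inverseˡ d ⟩
      0#                             ∎

  eliminate : ∀ n (p : Fin n) c′ → c′ ≢ 0# → (g : Vec Carrier n → Carrier) →
    (∀ x v → g (x [ p ]≔ v) ≡ g x) → (W : Vec Carrier n → ℕ) → (∀ x v → W (x [ p ]≔ v) ≡ W x) →
    q * (∑[ x ∈ allVecs n ] (⟦ ((c′ *F lookup x p) +F g x) ≟ 0# ⟧ * W x)) ≡ ∑ (allVecs n) W
  eliminate (suc n) Fin.zero c′ c′≢0 g g-indep W W-indep = begin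
    q * ∑ (allVecs (suc n)) _
        ≡⟨ cong (q *_) (∑-allVecs n _) ⟩
    q * (∑[ a ∈ elements ] ∑[ y ∈ allVecs n ] (E a y * W (a ∷ y)))
        ≡⟨ cong (q *_) (∑-cong elements (λ a → ∑-cong (allVecs n) (freeze a))) ⟩
    q * (∑[ a ∈ elements ] ∑[ y ∈ allVecs n ] (E₀ a y * W₀ y))
        ≡⟨ cong (q *_) (∑-swap elements (allVecs n) _) ⟩
    q * (∑[ y ∈ allVecs n ] ∑[ a ∈ elements ] (E₀ a y * W₀ y))
        ≡⟨ cong (q *_) (∑-cong (allVecs n) one-root) ⟩
    q * ∑ (allVecs n) W₀
        ≡⟨ sym (∑-const elements _) ⟩
    (∑[ a ∈ elements ] ∑[ y ∈ allVecs n ] W₀ y)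
        ≡⟨ ∑-cong elements (λ a → ∑-cong (allVecs n) (λ y → sym (W-indep (0# ∷ y) a))) ⟩
    (∑[ a ∈ elements ] ∑[ y ∈ allVecs n ] W (a ∷ y))
        ≡⟨ sym (∑-allVecs n W) ⟩
    ∑ (allVecs (suc n)) W
        ∎
    where
    E : Carrier → Vec Carrier n → ℕ
    E a y = ⟦ ((c′ *F a) +F g (a ∷ y)) ≟ 0# ⟧
    E₀ : Carrier → Vec Carrier n → ℕ
    E₀ a y = ⟦ ((c′ *F a) +F g (0# ∷ y)) ≟ 0# ⟧
    W₀ : Vec Carrier n → ℕ
    W₀ y = W (0# ∷ y)
    freeze : ∀ a y → E a y * W (a ∷ y) ≡ E₀ a y * W₀ y
    freeze a y = cong₂ _*_ (⟦⟧-≡0 (cong ((c′ *F a) +F_) (g-indep (0# ∷ y) a))) (W-indep (0# ∷ y) a)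
    one-root : ∀ y → (∑[ a ∈ elements ] (E₀ a y * W₀ y)) ≡ W₀ y
    one-root y = trans (∑-*ʳ elements (W₀ y) _)
                       (trans (cong (_* W₀ y) (count-linear-root c′ c′≢0 (g (0# ∷ y)))) (ℕP.*-identityˡ _))
  eliminate (suc n) (Fin.suc p) c′ c′≢0 g g-indep W W-indep = begin
    q * ∑ (allVecs (suc n)) _
        ≡⟨ cong (q *_) (∑-allVecs n _) ⟩
    q * (∑[ a ∈ elements ] ∑[ y ∈ allVecs n ] E a y)
        ≡⟨ sym (∑-*ˡ elements q _) ⟩
    (∑[ a ∈ elements ] (q * ∑[ y ∈ allVecs n ] E a y))
        ≡⟨ ∑-cong elements (λ a → eliminate n p c′ c′≢0 (λ y → g (a ∷ y)) (λ y → g-indep (a ∷ y))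
                                                         (λ y → W (a ∷ y)) (λ y → W-indep (a ∷ y))) ⟩
    (∑[ a ∈ elements ] ∑[ y ∈ allVecs n ] W (a ∷ y))
        ≡⟨ sym (∑-allVecs n W) ⟩
    ∑ (allVecs (suc n)) W
        ∎
    where
    E : Carrier → Vec Carrier n → ℕ
    E a y = ⟦ ((c′ *F lookup y p) +F g (a ∷ y)) ≟ 0# ⟧ * W (a ∷ y)

  ∑-first-coords : ∀ h k (h≤k : h ℕ.≤ k) (G : (Fin h → Carrier) → ℕ) →
    (∀ f f′ → (∀ t → f t ≡ f′ t) → G f ≡ G f′) →
    (∑[ x ∈ allVecs k ] G (λ t → lookup x (Fin.inject≤ t h≤k))) ≡ q ^ (k ∸ h) * (∑[ y ∈ allVecs h ] G (lookup y))
  ∑-first-coords zero k h≤k G G-ext = begin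
    (∑[ x ∈ allVecs k ] G (λ t → lookup x (Fin.inject≤ t h≤k))) ≡⟨ ∑-cong (allVecs k) (λ x → G-ext _ _ (λ ())) ⟩
    (∑[ _ ∈ allVecs k ] G (lookup []))                          ≡⟨ ∑-allVecs-const k _ ⟩
    q ^ k * G (lookup [])                                       ≡⟨ cong (q ^ k *_) (sym (ℕP.+-identityʳ _)) ⟩
    q ^ k * (G (lookup []) + 0)                                 ∎
  ∑-first-coords (suc h) (suc k) (s≤s h≤k) G G-ext = begin
    (∑[ x ∈ allVecs (suc k) ] G (λ t → lookup x (Fin.inject≤ t (s≤s h≤k))))
        ≡⟨ ∑-allVecs k _ ⟩
    (∑[ a ∈ elements ] ∑[ y ∈ allVecs k ] G (λ t → lookup (a ∷ y) (Fin.inject≤ t (s≤s h≤k))))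
        ≡⟨ ∑-cong elements (λ a → ∑-cong (allVecs k) (λ y → G-ext _ _ (inject-cons a y))) ⟩
    (∑[ a ∈ elements ] ∑[ y ∈ allVecs k ] G (a ◂ (λ t → lookup y (Fin.inject≤ t h≤k))))
        ≡⟨ ∑-cong elements (λ a → ∑-first-coords h k h≤k (λ f → G (a ◂ f)) (λ f f′ e → G-ext _ _ (◂-ext e))) ⟩
    (∑[ a ∈ elements ] (q ^ (k ∸ h) * ∑[ y ∈ allVecs h ] G (a ◂ lookup y)))
        ≡⟨ ∑-*ˡ elements (q ^ (k ∸ h)) _ ⟩
    q ^ (k ∸ h) * (∑[ a ∈ elements ] ∑[ y ∈ allVecs h ] G (a ◂ lookup y))
        ≡⟨ cong (q ^ (k ∸ h) *_) (∑-cong elements (λ a → ∑-cong (allVecs h) (λ y → G-ext _ _ (◂-lookup a y)))) ⟩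
    q ^ (k ∸ h) * (∑[ a ∈ elements ] ∑[ y ∈ allVecs h ] G (lookup (a ∷ y)))
        ≡⟨ cong (q ^ (k ∸ h) *_) (sym (∑-allVecs h _)) ⟩
    q ^ (k ∸ h) * (∑[ y ∈ allVecs (suc h) ] G (lookup y))
        ∎
    where
    inject-cons : ∀ a y t → lookup (a ∷ y) (Fin.inject≤ t (s≤s h≤k)) ≡ (a ◂ (λ t → lookup y (Fin.inject≤ t h≤k))) t
    inject-cons a y Fin.zero = refl
    inject-cons a y (Fin.suc t) = refl
    ◂-lookup : ∀ {n} a (y : Vec Carrier n) t → (a ◂ lookup y) t ≡ lookup (a ∷ y) t
    ◂-lookup a y Fin.zero = refl
    ◂-lookup a y (Fin.suc t) = refl
    ◂-ext : ∀ {n a} {f f′ : Fin n → Carrier} → (∀ t → f t ≡ f′ t) → ∀ t → (a ◂ f) t ≡ (a ◂ f′) t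
    ◂-ext e Fin.zero = refl
    ◂-ext e (Fin.suc t) = e t

  sumF-cong : ∀ n {f f′ : Fin n → Carrier} → (∀ t → f t ≡ f′ t) → sumF n f ≡ sumF n f′
  sumF-cong zero e = refl
  sumF-cong (suc n) e = cong₂ _+F_ (e Fin.zero) (sumF-cong n (λ t → e (Fin.suc t)))

  prodF-cong : ∀ n {f f′ : Fin n → Carrier} → (∀ t → f t ≡ f′ t) → prodF n f ≡ prodF n f′
  prodF-cong zero e = refl
  prodF-cong (suc n) e = cong₂ _*F_ (e Fin.zero) (prodF-cong n (λ t → e (Fin.suc t)))

  AllNonzero : ∀ n → Vec Carrier n → Set c
  AllNonzero n y = ∀ t → lookup y t ≢ 0#

  prod-≢0 : ∀ n (y : Vec Carrier n) → AllNonzero n y → prodF n (lookup y) ≢ 0#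
  prod-≢0 zero [] _ = 1≢0
  prod-≢0 (suc n) (a ∷ y) nz = integral a _ (nz Fin.zero) (prod-≢0 n y (λ t → nz (Fin.suc t)))

  prod-≡0 : ∀ n (y : Vec Carrier n) → ¬ AllNonzero n y → prodF n (lookup y) ≡ 0#
  prod-≡0 zero [] ¬nz = ⊥-elim (¬nz (λ ()))
  prod-≡0 (suc n) (a ∷ y) ¬nz with a ≟ 0#
  ... | yes refl = R.zeroˡ _
  ... | no a≢0 = trans (cong (a *F_) (prod-≡0 n y ¬tail)) (R.zeroʳ a)
    where
    ¬tail : ¬ AllNonzero n y
    ¬tail nz = ¬nz (λ { Fin.zero → a≢0 ; (Fin.suc t) → nz t })

  Z : ∀ h → Vec Carrier h → ℕ
  Z h y = ⟦ (sumF h (lookup y) *F prodF h (lookup y)) ≟ 0# ⟧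

  -- Pointwise form of the splitting: if all y_i ≠ 0 then Z h y is the
  -- indicator of Σ y = 0, and otherwise Z h y = 1.
  Z-split : ∀ h (y : Vec Carrier h) →
    Z h y + ⟦ nonzeroAll? h y ⟧ ≡ 1 + ⟦ sumF h (lookup y) ≟ 0# ⟧ * ⟦ nonzeroAll? h y ⟧
  Z-split h y with nonzeroAll? h y
  ... | yes nz = trans (ℕP.+-comm (Z h y) 1) (cong suc (trans
          (⟦⟧-⇔ sum≡0 product≡0 ((Σy *F Πy) ≟ 0#) (Σy ≟ 0#)) (sym (ℕP.*-identityʳ _))))
    where
    Σy Πy : Carrier
    Σy = sumF h (lookup y)
    Πy = prodF h (lookup y)
    sum≡0 : Σy *F Πy ≡ 0# → Σy ≡ 0#
    sum≡0 e with Σy ≟ 0#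
    ... | yes Σy≡0 = Σy≡0
    ... | no Σy≢0 = ⊥-elim (integral _ _ Σy≢0 (prod-≢0 h y nz) e)
    product≡0 : Σy ≡ 0# → Σy *F Πy ≡ 0#
    product≡0 e = trans (cong (_*F Πy) e) (R.zeroˡ _)
  ... | no ¬nz with (sumF h (lookup y) *F prodF h (lookup y)) ≟ 0#
  ...   | yes _ = cong suc (sym (ℕP.*-zeroʳ ⟦ sumF h (lookup y) ≟ 0# ⟧))
  ...   | no ≢0 = ⊥-elim (≢0 (trans (cong (sumF h (lookup y) *F_) (prod-≡0 h y ¬nz)) (R.zeroʳ _)))

  count-allNonzero : ∀ h → (∑[ y ∈ allVecs h ] ⟦ nonzeroAll? h y ⟧) ≡ (q ∸ 1) ^ h
  count-allNonzero zero = refl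
  count-allNonzero (suc h) = begin
    (∑[ y ∈ allVecs (suc h) ] ⟦ nonzeroAll? (suc h) y ⟧)                 ≡⟨ ∑-allVecs h _ ⟩
    (∑[ a ∈ elements ] ∑[ y ∈ allVecs h ] ⟦ nonzeroAll? (suc h) (a ∷ y) ⟧)
        ≡⟨ ∑-cong elements (λ a → ∑-cong (allVecs h) (λ y → head-and-tail a y)) ⟩
    (∑[ a ∈ elements ] ∑[ y ∈ allVecs h ] (⟦ ¬? (a ≟ 0#) ⟧ * ⟦ nonzeroAll? h y ⟧))
        ≡⟨ ∑-cong elements (λ a → ∑-*ˡ (allVecs h) ⟦ ¬? (a ≟ 0#) ⟧ _) ⟩
    (∑[ a ∈ elements ] (⟦ ¬? (a ≟ 0#) ⟧ * ∑[ y ∈ allVecs h ] ⟦ nonzeroAll? h y ⟧))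
        ≡⟨ ∑-*ʳ elements _ _ ⟩
    (∑[ a ∈ elements ] ⟦ ¬? (a ≟ 0#) ⟧) * (∑[ y ∈ allVecs h ] ⟦ nonzeroAll? h y ⟧)
        ≡⟨ cong₂ _*_ count-≢0 (count-allNonzero h) ⟩
    (q ∸ 1) * (q ∸ 1) ^ h                                               ∎
    where
    head-and-tail : ∀ a y → ⟦ nonzeroAll? (suc h) (a ∷ y) ⟧ ≡ ⟦ ¬? (a ≟ 0#) ⟧ * ⟦ nonzeroAll? h y ⟧
    head-and-tail a y = trans
      (⟦⟧-⇔ (λ nz → nz Fin.zero , (λ t → nz (Fin.suc t)))
            (λ { (a≢0 , nz) → λ { Fin.zero → a≢0 ; (Fin.suc t) → nz t } })
            (nonzeroAll? (suc h) (a ∷ y)) (¬? (a ≟ 0#) ×-dec nonzeroAll? h y))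
      (⟦⟧-× (¬? (a ≟ 0#)) (nonzeroAll? h y))

  count-Z : ∀ h → ∑ (allVecs h) (Z h) + (q ∸ 1) ^ h ≡ q ^ h + ψ h
  count-Z h = begin
    ∑ (allVecs h) (Z h) + (q ∸ 1) ^ h           ≡⟨ cong (_+_ (∑ (allVecs h) (Z h))) (sym (count-allNonzero h)) ⟩
    ∑ (allVecs h) (Z h) + ∑ (allVecs h) nz      ≡⟨ sym (∑-+ (allVecs h) (Z h) nz) ⟩
    (∑[ y ∈ allVecs h ] (Z h y + nz y))         ≡⟨ ∑-cong (allVecs h) (Z-split h) ⟩
    (∑[ y ∈ allVecs h ] (1 + zs y * nz y))      ≡⟨ ∑-+ (allVecs h) _ _ ⟩
    (∑[ _ ∈ allVecs h ] 1) + (∑[ y ∈ allVecs h ] (zs y * nz y))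
        ≡⟨ cong₂ _+_ (trans (∑-allVecs-const h 1) (ℕP.*-identityʳ _)) (sym ψ-as-sum) ⟩
    q ^ h + ψ h                                 ∎
    where
    nz zs : Vec Carrier h → ℕ
    nz y = ⟦ nonzeroAll? h y ⟧
    zs y = ⟦ sumF h (lookup y) ≟ 0# ⟧
    ψ-as-sum : ψ h ≡ (∑[ y ∈ allVecs h ] (zs y * nz y))
    ψ-as-sum = trans (length-filter _ (allVecs h))
                     (∑-cong (allVecs h) (λ y → ⟦⟧-× (sumF h (lookup y) ≟ 0#) (nonzeroAll? h y)))

  -- The main count: eliminating x_{j₁} and then the coordinates beyond h gives
  -- q · Λ = q^(k−h) · Z_h.
  q*Λ-count : ∀ h k (h≤k : h ℕ.≤ k) s r (i : Fin s → Fin h) (j : Fin (suc r) → Fin k) →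
    (∀ t u → t Fin.< u → j t Fin.< j u) → (∀ t → h ℕ.≤ toℕ (j t)) →
    (a : Fin s → Carrier) (b : Fin (suc r) → Carrier) → b Fin.zero ≢ 0# →
    q * Λ h k h≤k s (suc r) i a j b ≡ q ^ (k ∸ h) * ∑ (allVecs h) (Z h)
  q*Λ-count h k h≤k s r i j j-mono j-large a b b₁≢0 = begin
    q * Λ h k h≤k s (suc r) i a j b
        ≡⟨ cong (q *_) (trans (length-filter _ (allVecs k))
                              (∑-cong (allVecs k) (λ x → ⟦⟧-× (L x ≟ 0#) (M x ≟ 0#)))) ⟩
    q * (∑[ x ∈ allVecs k ] (⟦ L x ≟ 0# ⟧ * W x))
        ≡⟨ cong (q *_) (∑-cong (allVecs k) (λ x → cong (_* W x) (⟦⟧-≡0 (L-split x)))) ⟩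
    q * (∑[ x ∈ allVecs k ] (⟦ ((b Fin.zero *F lookup x p) +F g x) ≟ 0# ⟧ * W x))
        ≡⟨ eliminate k p (b Fin.zero) b₁≢0 g g-indep W W-indep ⟩
    ∑ (allVecs k) W
        ≡⟨ ∑-first-coords h k h≤k (λ f → ⟦ (sumF h f *F prodF h f) ≟ 0# ⟧)
             (λ f f′ e → ⟦⟧-≡0 (cong₂ _*F_ (sumF-cong h e) (prodF-cong h e))) ⟩
    q ^ (k ∸ h) * ∑ (allVecs h) (Z h) ∎
    where
    p : Fin k
    p = j Fin.zero
    xh : Vec Carrier k → Fin h → Carrier
    xh x t = lookup x (Fin.inject≤ t h≤k)
    A B : Vec Carrier k → Carrier
    A x = sumF s (λ t → a t *F xh x (i t))
    B x = sumF r (λ t → b (Fin.suc t) *F lookup x (j (Fin.suc t)))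
    L g M : Vec Carrier k → Carrier
    L x = A x +F sumF (suc r) (λ t → b t *F lookup x (j t))
    g x = A x +F B x
    M x = sumF h (xh x) *F prodF h (xh x)
    W : Vec Carrier k → ℕ
    W x = ⟦ M x ≟ 0# ⟧
    L-split : ∀ x → L x ≡ (b Fin.zero *F lookup x p) +F g x
    L-split x = begin
      A x +F ((b Fin.zero *F lookup x p) +F B x) ≡⟨ sym (R.+-assoc _ _ _) ⟩
      (A x +F (b Fin.zero *F lookup x p)) +F B x ≡⟨ cong (_+F B x) (R.+-comm _ _) ⟩
      ((b Fin.zero *F lookup x p) +F A x) +F B x ≡⟨ R.+-assoc _ _ _ ⟩
      (b Fin.zero *F lookup x p) +F g x          ∎
    p≢first : ∀ t → Fin.inject≤ t h≤k ≢ p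
    p≢first t e = ℕP.<⇒≢ (ℕP.<-≤-trans (FinP.toℕ<n t) (j-large Fin.zero))
                         (trans (sym (FinP.toℕ-inject≤ t h≤k)) (cong toℕ e))
    p≢later : ∀ t → j (Fin.suc t) ≢ p
    p≢later t e = FinP.<⇒≢ (j-mono Fin.zero (Fin.suc t) (s≤s z≤n)) (sym e)
    xh-indep : ∀ x v t → xh (x [ p ]≔ v) t ≡ xh x t
    xh-indep x v t = lookup∘update′ (p≢first t) x v
    g-indep : ∀ x v → g (x [ p ]≔ v) ≡ g x
    g-indep x v = cong₂ _+F_ (sumF-cong s (λ t → cong (a t *F_) (xh-indep x v (i t))))
                             (sumF-cong r (λ t → cong (b (Fin.suc t) *F_) (lookup∘update′ (p≢later t) x v)))
    W-indep : ∀ x v → W (x [ p ]≔ v) ≡ W x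
    W-indep x v = ⟦⟧-≡0 (cong₂ _*F_ (sumF-cong h (xh-indep x v)) (prodF-cong h (xh-indep x v)))

k≡1+h+m : ∀ {h k} → h ℕ.< k → k ≡ suc (h + (k ∸ h ∸ 1))
k≡1+h+m {zero} {suc k} _ = refl
k≡1+h+m {suc h} {suc k} (s≤s h<k) = cong suc (k≡1+h+m h<k)

k∸h≡1+m : ∀ {h k} → h ℕ.< k → k ∸ h ≡ suc (k ∸ h ∸ 1)
k∸h≡1+m {zero} {suc k} _ = refl
k∸h≡1+m {suc h} {suc k} (s≤s h<k) = k∸h≡1+m h<k

pos-^ : ∀ a n → + (a ^ n) ≡ (+ a) ℤ.^ n
pos-^ a zero = refl
pos-^ a (suc n) = trans (ℤP.pos-* a (a ^ n)) (cong ((+ a) ℤ.*_) (pos-^ a n))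

integer-form : ∀ {q h m n T P} → 1 ℕ.≤ q → n ≡ h + m → T + (q ∸ 1) ^ h ≡ q ^ h + P →
  + (q ^ m * T) ≡ (+ q) ℤ.^ n ℤ.- (+ q) ℤ.^ m ℤ.* (+ q ℤ.- ℤ.1ℤ) ℤ.^ h ℤ.+ + P ℤ.* (+ q) ℤ.^ m
integer-form {suc q′} {h} {m} {n} {T} {P} _ refl count = begin
  + (Q ^ m * T)                     ≡⟨ trans (ℤP.pos-* (Q ^ m) T) (cong₂ ℤ._*_ (pos-^ Q m) T≡) ⟩
  Y ℤ.* ((X ℤ.+ + P) ℤ.- D)         ≡⟨ expand Y X (+ P) D ⟩
  X ℤ.* Y ℤ.- Y ℤ.* D ℤ.+ + P ℤ.* Y ≡⟨ cong (λ z → z ℤ.- Y ℤ.* D ℤ.+ + P ℤ.* Y) (sym (ℤP.^-distribˡ-+-* (+ Q) h m)) ⟩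
  (+ Q) ℤ.^ (h + m) ℤ.- Y ℤ.* D ℤ.+ + P ℤ.* Y ∎
  where
  Q : ℕ
  Q = suc q′
  X Y D : ℤ
  X = (+ Q) ℤ.^ h
  Y = (+ Q) ℤ.^ m
  D = (+ Q ℤ.- ℤ.1ℤ) ℤ.^ h
  expand : ∀ (y x p d : ℤ) → y ℤ.* ((x ℤ.+ p) ℤ.- d) ≡ x ℤ.* y ℤ.- y ℤ.* d ℤ.+ p ℤ.* y
  expand = solve-∀
  cancel : ∀ (t d : ℤ) → t ≡ (t ℤ.+ d) ℤ.- d
  cancel = solve-∀
  T≡ : + T ≡ (X ℤ.+ + P) ℤ.- D
  T≡ = begin
    + T                                       ≡⟨ cancel (+ T) (+ (q′ ^ h)) ⟩
    (+ T ℤ.+ + (q′ ^ h)) ℤ.- + (q′ ^ h)       ≡⟨ cong₂ (λ u v → u ℤ.- v) (sym (ℤP.pos-+ T _)) (pos-^ q′ h) ⟩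
    + (T + q′ ^ h) ℤ.- (+ q′) ℤ.^ h           ≡⟨ cong (λ u → + u ℤ.- (+ q′) ℤ.^ h) count ⟩
    + (Q ^ h + P) ℤ.- D                       ≡⟨ cong (ℤ._- D) (trans (ℤP.pos-+ (Q ^ h) P) (cong (ℤ._+ + P) (pos-^ Q h))) ⟩
    (X ℤ.+ + P) ℤ.- D                         ∎

proposition3 : ∀ {c : Level} (F : FiniteField c) →
    let open FiniteField F in
    (h k : ℕ) → 4 ℕ.≤ h → (h≤k : h ℕ.≤ k) →
    (s r : ℕ) → 1 ℕ.≤ r →
    (i : Fin s → Fin h) → (∀ t u → t Fin.< u → i t Fin.< i u) →
    (j : Fin r → Fin k) → (∀ t u → t Fin.< u → j t Fin.< j u) →
    (∀ t → h ℕ.≤ toℕ (j t)) →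
    (a : Fin s → Carrier) → (∀ t → a t ≢ 0#) →
    (b : Fin r → Carrier) → (∀ t → b t ≢ 0#) →
    (+ Λ h k h≤k s r i a j b)
      ≡ (+ order) ℤ.^ (k ∸ 1)
        ℤ.- (+ order) ℤ.^ (k ∸ h ∸ 1) ℤ.* (+ order ℤ.- ℤ.1ℤ) ℤ.^ h
        ℤ.+ + ψ h ℤ.* (+ order) ℤ.^ (k ∸ h ∸ 1)
proposition3 F h k _ h≤k s (suc r) (s≤s z≤n) i _ j j-mono j-large a _ b b≢0 =
  trans (cong +_ Λ≡) (integer-form {h = h} {m = m} order-pos (cong (_∸ 1) (k≡1+h+m h<k)) (count-Z h))
  where
  open FiniteField F using (Λ; allVecs)
  open Counting F using (q; order-pos; Z; count-Z; q*Λ-count)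
  h<k : h ℕ.< k
  h<k = ℕP.≤-<-trans (j-large Fin.zero) (FinP.toℕ<n (j Fin.zero))
  m T : ℕ
  m = k ∸ h ∸ 1
  T = ∑ (allVecs h) (Z h)
  instance
    q≢0 : ℕ.NonZero q
    q≢0 = ℕ.>-nonZero order-pos
  Λ≡ : Λ h k h≤k s (suc r) i a j b ≡ q ^ m * T
  Λ≡ = ℕP.*-cancelˡ-≡ _ _ q (begin
    q * Λ h k h≤k s (suc r) i a j b ≡⟨ q*Λ-count h k h≤k s r i j j-mono j-large a b (b≢0 Fin.zero) ⟩
    q ^ (k ∸ h) * T                 ≡⟨ cong (λ e → q ^ e * T) (k∸h≡1+m h<k) ⟩
    q * q ^ m * T                   ≡⟨ ℕP.*-assoc q (q ^ m) T ⟩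
    q * (q ^ m * T)                 ∎)
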